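{- Let $p\geq 3$ be an odd integer and let $\tau$ be the permutation of $\{0,1,\dots,p-2\}$ defined by $\tau(j)\equiv 2j+1\pmod p$. There is a cycle of odd length in the cycle decomposition of $\tau$ if and only if $p=mp_1$ for some integer $m\geq 1$ and some integer $p_1\geq 3$ with $\mu(p_1)$ odd.
   Context: For an odd integer $q\geq 3$, $\mu(q)=\mathrm{ord}_q(2)=\min\{j\geq 1: q\mid 2^j-1\}$. Cycles of length $1$ count as odd cycles. -}

module Defs where

open import Data.Nat using (ℕ; zero; suc; _+_; _*_; _∸_; _^_; _≤_; _<_; NonZero)
open import Data.Nat.DivMod using (_%_)
open import Data.Nat.Divisibility using (_∣_)
open import Data.Product using (Σ; _×_)
open import Relation.Binary.PropositionalEquality using (_≡_)
open import Relation.Nullary using (¬_)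

Odd : ℕ → Set
Odd n = Σ ℕ λ t → n ≡ 2 * t + 1

-- τ(j) = (2j+1) mod p, viewed on ℕ (it maps {0,…,p-2} into itself for odd p)
tau : (p : ℕ) → .{{NonZero p}} → ℕ → ℕ
tau p j = (2 * j + 1) % p

tauIter : (p : ℕ) → .{{NonZero p}} → ℕ → ℕ → ℕ
tauIter p zero    j = j
tauIter p (suc k) j = tau p (tauIter p k j)

CycleLength : (p : ℕ) → .{{NonZero p}} → ℕ → ℕ → Set
CycleLength p j k =
  1 ≤ k × tauIter p k j ≡ j × (∀ i → 1 ≤ i → i < k → ¬ (tauIter p i j ≡ j))

HasOddCycle : (p : ℕ) → .{{NonZero p}} → Set
HasOddCycle p = Σ ℕ λ j → j < p ∸ 1 × Σ ℕ λ k → CycleLength p j k × Odd k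

IsMu : ℕ → ℕ → Set
IsMu q k = 1 ≤ k × q ∣ (2 ^ k ∸ 1) × (∀ j → 1 ≤ j → j < k → ¬ (q ∣ (2 ^ j ∸ 1)))

-- Shifting by one turns τ into doubling: τ(j) + 1 ≡ 2 (j + 1) (mod p), so
-- τᵏ(j) = j exactly when p ∣ (2ᵏ - 1)(j + 1).  Writing p = q·d and
-- j + 1 = y·d with q and y coprime (d = gcd(p, j + 1)), this divisibility is
-- equivalent to q ∣ 2ᵏ - 1.  Hence the cycle of j has length μ(q): both are
-- the least positive k satisfying pointwise equivalent conditions.
--
-- The theorem follows: an odd cycle through j
-- yields the factorisation p = gcd(p, j + 1) · q with μ(q) odd (q ≥ 3 since
-- p is odd and gcd(p, j + 1) < p), and a factorisation p = m·p₁ with μ(p₁)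
-- odd yields the odd cycle through j = m - 1.
module Submission where

open import Defs
open import Data.Nat using (ℕ; zero; suc; _+_; _*_; _∸_; _^_; _≤_; _<_; z≤n; s≤s; s≤s⁻¹; NonZero; ≢-nonZero)
open import Data.Nat.Properties
open import Data.Nat.DivMod
open import Data.Nat.Divisibility
open import Data.Nat.GCD using (gcd; gcd[m,n]∣m; gcd[m,n]∣n; gcd[m,n]≢0)
open import Data.Nat.Coprimality using (Coprime; coprime-divisor; coprime-/gcd; 1-coprimeTo)
import Data.Nat.Coprimality as Coprimality
open import Data.Product using (Σ; _×_; _,_)
open import Data.Sum using (inj₁; inj₂)
open import Relation.Nullary using (¬_; contradiction)
open import Relation.Binary.PropositionalEquality
open import Function.Bundles using (_⇔_; mk⇔; Equivalence)
open import Function.Properties.Equivalence using () renaming (trans to ⇔-trans)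

LeastPositive : (ℕ → Set) → ℕ → Set
LeastPositive P k = 1 ≤ k × P k × (∀ i → 1 ≤ i → i < k → ¬ P i)

leastPositive-cong : {P Q : ℕ → Set} → (∀ i → P i ⇔ Q i)
  → ∀ k → LeastPositive P k ⇔ LeastPositive Q k
leastPositive-cong P⇔Q k = mk⇔ (transport (λ i → Equivalence.to (P⇔Q i)) (λ i → Equivalence.from (P⇔Q i)))
                               (transport (λ i → Equivalence.from (P⇔Q i)) (λ i → Equivalence.to (P⇔Q i)))
  where
    transport : {A B : ℕ → Set} → (∀ i → A i → B i) → (∀ i → B i → A i)
      → LeastPositive A k → LeastPositive B k
    transport A⇒B B⇒A (1≤k , Ak , minimal) =
      1≤k , A⇒B k Ak , λ i 1≤i i<k Bi → minimal i 1≤i i<k (B⇒A i Bi)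

pow-split : ∀ k x → 2 ^ k * x ≡ (2 ^ k ∸ 1) * x + x
pow-split k x = begin
    2 ^ k * x                  ≡⟨ cong (_* x) (sym (m∸n+n≡m (m^n>0 2 k))) ⟩
    ((2 ^ k ∸ 1) + 1) * x      ≡⟨ *-distribʳ-+ x (2 ^ k ∸ 1) 1 ⟩
    (2 ^ k ∸ 1) * x + 1 * x    ≡⟨ cong ((2 ^ k ∸ 1) * x +_) (*-identityˡ x) ⟩
    (2 ^ k ∸ 1) * x + x        ∎
  where open ≡-Reasoning

module Orbit (p : ℕ) .{{_ : NonZero p}} where

  %-absorb-suc : ∀ a → suc (a % p) % p ≡ suc a % p
  %-absorb-suc a = sym (begin
      suc a % p                       ≡⟨ cong (λ z → suc z % p) (m≡m%n+[m/n]*n a p) ⟩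
      (suc (a % p) + a / p * p) % p   ≡⟨ [m+kn]%n≡m%n (suc (a % p)) (a / p) p ⟩
      suc (a % p) % p                 ∎)
    where open ≡-Reasoning

  %-absorbʳ-* : ∀ a b → (a * (b % p)) % p ≡ (a * b) % p
  %-absorbʳ-* a b = begin
      (a * (b % p)) % p           ≡⟨ %-distribˡ-* a (b % p) p ⟩
      (a % p * (b % p % p)) % p   ≡⟨ cong (λ z → (a % p * z) % p) (m%n%n≡m%n b p) ⟩
      (a % p * (b % p)) % p       ≡⟨ sym (%-distribˡ-* a b p) ⟩
      (a * b) % p                 ∎
    where open ≡-Reasoning

  tauIter-shift : ∀ k j → suc (tauIter p k j) % p ≡ (2 ^ k * suc j) % p
  tauIter-shift zero    j = cong (_% p) (sym (*-identityˡ (suc j)))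
  tauIter-shift (suc k) j = begin
      suc ((2 * t + 1) % p) % p        ≡⟨ %-absorb-suc (2 * t + 1) ⟩
      suc (2 * t + 1) % p              ≡⟨ cong (_% p) (doubleSucc t) ⟩
      (2 * suc t) % p                  ≡⟨ sym (%-absorbʳ-* 2 (suc t)) ⟩
      (2 * (suc t % p)) % p            ≡⟨ cong (λ z → (2 * z) % p) (tauIter-shift k j) ⟩
      (2 * ((2 ^ k * suc j) % p)) % p  ≡⟨ %-absorbʳ-* 2 (2 ^ k * suc j) ⟩
      (2 * (2 ^ k * suc j)) % p        ≡⟨ cong (_% p) (sym (*-assoc 2 (2 ^ k) (suc j))) ⟩
      (2 ^ suc k * suc j) % p          ∎
    where
      open ≡-Reasoning
      t = tauIter p k j
      doubleSucc : ∀ n → suc (2 * n + 1) ≡ 2 * suc n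
      doubleSucc n = trans (cong suc (+-comm (2 * n) 1)) (sym (*-suc 2 n))

  %-shift⇔∣ : ∀ W x → (W + x) % p ≡ x % p ⇔ p ∣ W
  %-shift⇔∣ W x = mk⇔ sameResidue⇒∣ (λ p∣W → %-remove-+ˡ x p∣W)
    where
      open ≡-Reasoning
      sameResidue⇒∣ : (W + x) % p ≡ x % p → p ∣ W
      sameResidue⇒∣ eq = divides ((W + x) / p ∸ x / p) (begin
          W                                                      ≡⟨ sym (m+n∸n≡m W x) ⟩
          (W + x) ∸ x                                            ≡⟨ cong₂ _∸_ (m≡m%n+[m/n]*n (W + x) p) (m≡m%n+[m/n]*n x p) ⟩
          ((W + x) % p + (W + x) / p * p) ∸ (x % p + x / p * p)  ≡⟨ cong (λ z → (z + (W + x) / p * p) ∸ (x % p + x / p * p)) eq ⟩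
          (x % p + (W + x) / p * p) ∸ (x % p + x / p * p)        ≡⟨ [m+n]∸[m+o]≡n∸o (x % p) _ _ ⟩
          (W + x) / p * p ∸ x / p * p                            ≡⟨ sym (*-distribʳ-∸ p ((W + x) / p) (x / p)) ⟩
          ((W + x) / p ∸ x / p) * p                              ∎)

  suc-residue-injective : ∀ {a x} → a < p → suc x < p → suc a % p ≡ suc x → a ≡ x
  suc-residue-injective a<p sx<p eq with m≤n⇒m<n∨m≡n a<p
  ... | inj₁ sa<p = suc-injective (trans (sym (m<n⇒m%n≡m sa<p)) eq)
  ... | inj₂ sa≡p = contradiction (trans (sym (n%n≡0 p)) (trans (cong (_% p) (sym sa≡p)) eq)) 0≢1+n

  tauIter-< : ∀ k {j} → j < p → tauIter p k j < p
  tauIter-< zero    j<p = j<p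
  tauIter-< (suc k) j<p = m%n<n _ p

  fixedPoint⇔∣ : ∀ k j → suc j < p → tauIter p k j ≡ j ⇔ p ∣ (2 ^ k ∸ 1) * suc j
  fixedPoint⇔∣ k j sj<p = mk⇔
      (λ fixed → Equivalence.to (%-shift⇔∣ W x) (trans (sym shifted) (cong (λ z → suc z % p) fixed)))
      (λ p∣W → suc-residue-injective (tauIter-< k (<-trans (n<1+n j) sj<p)) sj<p
                 (trans shifted (trans (Equivalence.from (%-shift⇔∣ W x) p∣W) (m<n⇒m%n≡m sj<p))))
    where
      x = suc j
      W = (2 ^ k ∸ 1) * x
      shifted : suc (tauIter p k j) % p ≡ (W + x) % p
      shifted = trans (tauIter-shift k j) (cong (_% p) (pow-split k x))

open Orbit using (fixedPoint⇔∣)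

scaled-∣⇔ : ∀ {p q d x y} .{{_ : NonZero d}} → p ≡ q * d → x ≡ y * d → Coprime q y
  → ∀ W → p ∣ W * x ⇔ q ∣ W
scaled-∣⇔ {p} {q} {d} {x} {y} p≡qd x≡yd q⊥y W = mk⇔ cancel scale
  where
    Wx≡Wyd : W * x ≡ W * y * d
    Wx≡Wyd = trans (cong (W *_) x≡yd) (sym (*-assoc W y d))
    cancel : p ∣ W * x → q ∣ W
    cancel p∣Wx = coprime-divisor q⊥y (subst (q ∣_) (*-comm W y)
                    (*-cancelʳ-∣ d (subst₂ _∣_ p≡qd Wx≡Wyd p∣Wx)))
    scale : q ∣ W → p ∣ W * x
    scale q∣W = subst₂ _∣_ (sym p≡qd) (sym Wx≡Wyd) (*-monoˡ-∣ d (∣m⇒∣m*n y q∣W))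

cycleLength⇔mu : ∀ {p} .{{_ : NonZero p}} {j q d y} .{{_ : NonZero d}}
  → suc j < p → p ≡ q * d → suc j ≡ y * d → Coprime q y
  → ∀ k → CycleLength p j k ⇔ IsMu q k
cycleLength⇔mu {p} {j} {q} sj<p p≡qd sj≡yd q⊥y =
  leastPositive-cong λ i → ⇔-trans (fixedPoint⇔∣ p i j sj<p) (scaled-∣⇔ p≡qd sj≡yd q⊥y (2 ^ i ∸ 1))

-- A cofactor q of an odd p = q·d with d < p is at least 3: q ≠ 0 and q ≠ 1
-- since d < p, and q ≠ 2 since p is odd.
oddCofactor≥3 : ∀ {p q d} → Odd p → p ≡ q * d → d < p → 3 ≤ q
oddCofactor≥3 {q = 0}                 _         p≡0  d<p = contradiction (subst (_ <_) p≡0 d<p) (λ ())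
oddCofactor≥3 {q = 1} {d}             _         p≡d  d<p = contradiction (subst (d <_) (trans p≡d (+-identityʳ d)) d<p) (<-irrefl refl)
oddCofactor≥3 {q = 2} {d}             (t , p≡2t+1) p≡2d _ = contradiction (∣1⇒≡1 2∣1) (λ ())
  where
    2∣1 : 2 ∣ 1
    2∣1 = ∣m+n∣m⇒∣n (subst (2 ∣_) (trans (sym p≡2d) p≡2t+1) (divides d (*-comm 2 d))) (∣m⇒∣m*n t (∣-refl {2}))
oddCofactor≥3 {q = suc (suc (suc _))} _         _    _   = s≤s (s≤s (s≤s z≤n))

<∸1⇔suc< : ∀ p {j} → j < p ∸ 1 ⇔ suc j < p
<∸1⇔suc< zero    = mk⇔ (λ ()) (λ ())
<∸1⇔suc< (suc p) = mk⇔ s≤s s≤s⁻¹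

OddOrderFactorisation : ℕ → Set
OddOrderFactorisation p = Σ ℕ λ m → Σ ℕ λ p₁ → 1 ≤ m × 3 ≤ p₁ × p ≡ m * p₁
                            × Σ ℕ λ k → IsMu p₁ k × Odd k

oddCycle⇒factorisation : ∀ p .{{_ : NonZero p}} → Odd p → HasOddCycle p → OddOrderFactorisation p
oddCycle⇒factorisation p odd-p (j , j<p∸1 , k , cycle , odd-k) =
  g , q , n≢0⇒n>0 g≢0 , oddCofactor≥3 odd-p p≡qg g<p , trans p≡qg (*-comm q g)
    , k , Equivalence.to (cycleLength⇔mu sj<p p≡qg (sym (m/n*n≡m (gcd[m,n]∣n p x))) (coprime-/gcd p x) k) cycle
    , odd-k
  where
    x = suc j
    sj<p = Equivalence.to (<∸1⇔suc< p) j<p∸1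
    g = gcd p x
    g≢0 = gcd[m,n]≢0 p x (inj₂ λ ())
    instance
      g-nonZero : NonZero g
      g-nonZero = ≢-nonZero g≢0
    q = p / g
    p≡qg : p ≡ q * g
    p≡qg = sym (m/n*n≡m (gcd[m,n]∣m p x))
    g<p : g < p
    g<p = ≤-<-trans (∣⇒≤ (gcd[m,n]∣n p x)) sj<p

factorisation⇒oddCycle : ∀ p .{{_ : NonZero p}} → OddOrderFactorisation p → HasOddCycle p
factorisation⇒oddCycle p (suc j , p₁ , _ , 3≤p₁ , p≡mp₁ , k , mu , odd-k) =
  j , Equivalence.from (<∸1⇔suc< p) m<p
    , k , Equivalence.from (cycleLength⇔mu m<p (trans p≡mp₁ (*-comm m p₁)) (sym (*-identityˡ m))
                                           (Coprimality.sym (1-coprimeTo p₁)) k) mu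
    , odd-k
  where
    m = suc j
    m<p : m < p
    m<p = subst₂ _<_ (*-identityʳ m) (sym p≡mp₁) (*-monoʳ-< m (≤-trans (s≤s (s≤s z≤n)) 3≤p₁))

proposition5p9 : (p : ℕ) → Odd p → 3 ≤ p → (nz : NonZero p)
    → HasOddCycle p {{nz}}
      ⇔ (Σ ℕ λ m → Σ ℕ λ p₁ → 1 ≤ m × 3 ≤ p₁ × p ≡ m * p₁
           × Σ ℕ λ k → IsMu p₁ k × Odd k)
proposition5p9 p odd-p _ nz =
  mk⇔ (oddCycle⇒factorisation p {{nz}} odd-p) (factorisation⇒oddCycle p {{nz}})
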